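{- Let $e,f,u$ be nonnegative integers with $u\ge\max\{e-f,\,f-e+2\}$. Then the map $\mathrm{switch}$ is a bijection from the set of words over $\{\mathtt t,\mathtt b\}$ with $e$ letters $\mathtt t$, $f$ letters $\mathtt b$ and exactly $u$ unmatched letters, onto the set of words over $\{\mathtt t,\mathtt b\}$ with $e-1$ letters $\mathtt t$, $f+1$ letters $\mathtt b$ and exactly $u$ unmatched letters.
   Context: A word $w_1\cdots w_{2n}$ over $\{\mathtt t,\mathtt b\}$ is a Dyck word if it has equally many $\mathtt t$'s and $\mathtt b$'s and in every prefix the number of $\mathtt b$'s does not exceed the number of $\mathtt t$'s (the empty word is a Dyck word). Every word $\mathbf w$ over $\{\mathtt t,\mathtt b\}$ factors uniquely as $\mathbf w=D_1\mathtt b D_2\mathtt b\cdots\mathtt b D_j\mathtt t D_{j+1}\mathtt t\cdots\mathtt t D_m$ with each $D_i$ a (possibly empty) Dyck word; the letters not belonging to any $D_i$ are called unmatched. If $\mathbf w$ has at least one unmatched $\mathtt t$, $\mathrm{switch}(\mathbf w)$ is the word obtained from $\mathbf w$ by replacing its leftmost unmatched $\mathtt t$ by $\mathtt b$. -}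

module Defs where

open import Data.Nat using (ℕ; zero; suc; _+_; _∸_; _≤_; _⊔_)
open import Data.List using (List; []; _∷_; _++_)
open import Data.Product using (Σ; ∃; ∃-syntax; _×_; _,_)
open import Relation.Binary.PropositionalEquality using (_≡_)

data Letter : Set where
  t b : Letter

Word : Set
Word = List Letter

#t : Word → ℕ
#t []       = 0
#t (t ∷ w)  = suc (#t w)
#t (b ∷ w)  = #t w

#b : Word → ℕ
#b []       = 0
#b (t ∷ w)  = #b w
#b (b ∷ w)  = suc (#b w)

data _≼_ : Word → Word → Set where
  []≼ : ∀ {w} → [] ≼ w
  ∷≼  : ∀ {x p w} → p ≼ w → (x ∷ p) ≼ (x ∷ w)

record Dyck (w : Word) : Set where
  field
    balanced : #t w ≡ #b w
    prefixes : ∀ p → p ≼ w → #b p ≤ #t p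

-- BSeq i x : x = D₁ b D₂ b ⋯ b D_{i+1} with each Dₖ a Dyck word
data BSeq : ℕ → Word → Set where
  bnil  : ∀ {D} → Dyck D → BSeq 0 D
  bsnoc : ∀ {i x D} → BSeq i x → Dyck D → BSeq (suc i) (x ++ (b ∷ D))

data TSeq : ℕ → Word → Set where
  tnil  : TSeq 0 []
  tcons : ∀ {k D y} → Dyck D → TSeq k y → TSeq (suc k) (t ∷ (D ++ y))

-- The factorization w = D₁ b ⋯ b D_j t D_{j+1} t ⋯ t D_m with
-- i = j-1 unmatched b's and k = m-j unmatched t's.
Factorization : Word → ℕ → ℕ → Set
Factorization w i k = ∃[ x ] ∃[ y ] (BSeq i x × TSeq k y × w ≡ x ++ y)

Unmatched : Word → ℕ → Set
Unmatched w u = ∃[ i ] ∃[ k ] (Factorization w i k × i + k ≡ u)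

-- Switch w w' : w has an unmatched t, and w' is w with its leftmost
-- unmatched t replaced by b.
Switch : Word → Word → Set
Switch w w' = ∃[ i ] ∃[ k ] ∃[ x ] ∃[ D ] ∃[ y ]
  (BSeq i x × Dyck D × TSeq k y ×
   w ≡ x ++ (t ∷ (D ++ y)) × w' ≡ x ++ (b ∷ (D ++ y)))

W : ℕ → ℕ → ℕ → Word → Set
W e f u w = #t w ≡ e × #b w ≡ f × Unmatched w u

-- Read t as an up-step and b as a down-step.  The factorization cuts a word
-- where the left part never dips below its final height while every nonempty
-- prefix of the right part rises strictly above its start; such a cut is
-- unique.  Hence switch is a partial function, and the same principle at the
-- last unmatched b of the image shows that it is injective, its inverse
-- turning that b back into t.  A word with i unmatched b's and k unmatched t's
-- satisfies #t + i = #b + k, so with i + k = u the bound u ≥ f − e + 2 forces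
-- an unmatched t (switch is defined), and u ≥ e − f forces an unmatched b in
-- every target word (switch is onto).
module Submission where

open import Defs
open import Data.Nat using (ℕ; zero; suc; _+_; _∸_; _≤_; _<_; z≤n; s≤s)
open import Data.Nat.Properties
open import Data.Nat.Tactic.RingSolver using (solve-∀)
open import Data.List using ([]; _∷_; _++_)
open import Data.List.Properties using (∷-injective; ∷-injectiveʳ; ++-assoc; ++-identityʳ; ++-cancelʳ)
open import Data.Product using (∃-syntax; _×_; _,_)
open import Data.Sum using (_⊎_; inj₁; inj₂)
open import Data.Empty using (⊥; ⊥-elim)
open import Relation.Binary.PropositionalEquality

private
  variable
    i i′ k k′ : ℕ
    w x x′ y y′ D D′ : Word

++-split : ∀ (a c x d : Word) → a ++ c ≡ x ++ d →
  (∃[ r ] (a ≡ x ++ r × d ≡ r ++ c)) ⊎ (∃[ r ] (x ≡ a ++ r × c ≡ r ++ d))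
++-split []      c x       d eq = inj₂ (x , refl , eq)
++-split (y ∷ a) c []      d eq = inj₁ (y ∷ a , refl , sym eq)
++-split (y ∷ a) c (z ∷ x) d eq with ∷-injective eq
... | refl , eq′ with ++-split a c x d eq′
...   | inj₁ (r , p , q) = inj₁ (r , cong (y ∷_) p , q)
...   | inj₂ (r , p , q) = inj₂ (r , cong (y ∷_) p , q)

≼-++ : ∀ (p z : Word) → p ≼ (p ++ z)
≼-++ []      z = []≼
≼-++ (_ ∷ p) z = ∷≼ (≼-++ p z)

#t-++ : ∀ a c → #t (a ++ c) ≡ #t a + #t c
#t-++ []      c = refl
#t-++ (t ∷ a) c = cong suc (#t-++ a c)
#t-++ (b ∷ a) c = #t-++ a c

#b-++ : ∀ a c → #b (a ++ c) ≡ #b a + #b c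
#b-++ []      c = refl
#b-++ (t ∷ a) c = #b-++ a c
#b-++ (b ∷ a) c = cong suc (#b-++ a c)

#t-switch : ∀ x z → #t (x ++ t ∷ z) ≡ suc (#t (x ++ b ∷ z))
#t-switch []      z = refl
#t-switch (t ∷ x) z = cong suc (#t-switch x z)
#t-switch (b ∷ x) z = #t-switch x z

#b-switch : ∀ x z → #b (x ++ b ∷ z) ≡ suc (#b (x ++ t ∷ z))
#b-switch []      z = refl
#b-switch (t ∷ x) z = #b-switch x z
#b-switch (b ∷ x) z = cong suc (#b-switch x z)

AboveStart StrictlyAboveStart AboveEnd StrictlyAboveEnd : Word → Set
AboveStart         w = ∀ p z   → p ++ z ≡ w       → #b p ≤ #t p
StrictlyAboveStart w = ∀ c p z → (c ∷ p) ++ z ≡ w → #b (c ∷ p) < #t (c ∷ p)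
AboveEnd           w = ∀ s q   → s ++ q ≡ w       → #t q ≤ #b q
StrictlyAboveEnd   w = ∀ s c q → s ++ c ∷ q ≡ w   → #t (c ∷ q) < #b (c ∷ q)

Dyck⇒AboveStart : Dyck D → AboveStart D
Dyck⇒AboveStart d p z refl = Dyck.prefixes d p (≼-++ p z)

Dyck⇒AboveEnd : Dyck D → AboveEnd D
Dyck⇒AboveEnd d s q refl = +-cancelˡ-≤ (#b s) (#t q) (#b q) (begin
  #b s + #t q  ≤⟨ +-monoˡ-≤ (#t q) (Dyck⇒AboveStart d s q refl) ⟩
  #t s + #t q  ≡⟨ sym (#t-++ s q) ⟩
  #t (s ++ q)  ≡⟨ Dyck.balanced d ⟩
  #b (s ++ q)  ≡⟨ #b-++ s q ⟩
  #b s + #b q  ∎)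
  where open ≤-Reasoning

AboveStart-++ : AboveStart x → AboveStart y → AboveStart (x ++ y)
AboveStart-++ {x} {y} hx hy p z eq with ++-split p z x y eq
... | inj₁ (r , refl , yr) rewrite #b-++ x r | #t-++ x r =
  +-mono-≤ (hx x [] (++-identityʳ x)) (hy r z (sym yr))
... | inj₂ (r , xr , _) = hx p r (sym xr)

AboveEnd-++ : AboveEnd x → AboveEnd y → AboveEnd (x ++ y)
AboveEnd-++ {x} {y} hx hy s q eq with ++-split s q x y eq
... | inj₁ (r , _ , yr) = hy r q (sym yr)
... | inj₂ (r , xr , refl) rewrite #t-++ r y | #b-++ r y =
  +-mono-≤ (hx s r (sym xr)) (hy [] y refl)

StrictlyAboveStart⇒AboveStart : StrictlyAboveStart w → AboveStart w
StrictlyAboveStart⇒AboveStart h []      z _  = z≤n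
StrictlyAboveStart⇒AboveStart h (c ∷ p) z eq = <⇒≤ (h c p z eq)

StrictlyAboveEnd⇒AboveEnd : StrictlyAboveEnd w → AboveEnd w
StrictlyAboveEnd⇒AboveEnd h s []      _  = z≤n
StrictlyAboveEnd⇒AboveEnd h s (c ∷ q) eq = <⇒≤ (h s c q eq)

AboveStart⇒StrictlyAboveStart-t∷ : AboveStart w → StrictlyAboveStart (t ∷ w)
AboveStart⇒StrictlyAboveStart-t∷ h c p z eq with ∷-injective eq
... | refl , eq′ = s≤s (h p z eq′)

AboveEnd⇒StrictlyAboveEnd-∷b : AboveEnd x → StrictlyAboveEnd (x ++ b ∷ [])
AboveEnd⇒StrictlyAboveEnd-∷b {x} h s c q eq with ++-split s (c ∷ q) x (b ∷ []) eq
... | inj₁ ([]        , _ , refl) = s≤s z≤n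
... | inj₁ (_ ∷ []    , _ , ())
... | inj₁ (_ ∷ _ ∷ _ , _ , ())
... | inj₂ (r , xr , cq) rewrite cq | #t-++ r (b ∷ []) | #b-++ r (b ∷ []) =
  +-mono-≤-< (h s r (sym xr)) (s≤s z≤n)

TSeq⇒StrictlyAboveStart : TSeq k y → StrictlyAboveStart y
TSeq⇒StrictlyAboveStart tnil         _ _ _ ()
TSeq⇒StrictlyAboveStart (tcons d ty) =
  AboveStart⇒StrictlyAboveStart-t∷
    (AboveStart-++ (Dyck⇒AboveStart d) (StrictlyAboveStart⇒AboveStart (TSeq⇒StrictlyAboveStart ty)))

BSeq⇒AboveEnd : BSeq i x → AboveEnd x
BSeq⇒AboveEnd (bnil d) = Dyck⇒AboveEnd d
BSeq⇒AboveEnd (bsnoc {x = x} {D = D} bx d) =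
  subst AboveEnd (++-assoc x (b ∷ []) D)
    (AboveEnd-++ (StrictlyAboveEnd⇒AboveEnd (AboveEnd⇒StrictlyAboveEnd-∷b (BSeq⇒AboveEnd bx)))
                 (Dyck⇒AboveEnd d))

Separated : Word → Word → Set
Separated x y = ∀ s c q z → s ++ c ∷ q ≡ x → (c ∷ q) ++ z ≡ y → ⊥

++-cut-unique : Separated x y′ → Separated x′ y → x ++ y ≡ x′ ++ y′ → x ≡ x′ × y ≡ y′
++-cut-unique {x} {y′} {x′} {y} sep sep′ eq with ++-split x y x′ y′ eq
... | inj₁ ([]    , xr  , yr) = trans xr (++-identityʳ x′) , sym yr
... | inj₁ (c ∷ q , xr  , yr) = ⊥-elim (sep x′ c q y (sym xr) (sym yr))
... | inj₂ ([]    , x′r , yr) = sym (trans x′r (++-identityʳ x)) , yr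
... | inj₂ (c ∷ q , x′r , yr) = ⊥-elim (sep′ x c q y′ (sym x′r) (sym yr))

++-cut-unique-↑ : AboveEnd x → StrictlyAboveStart y → AboveEnd x′ → StrictlyAboveStart y′ →
  x ++ y ≡ x′ ++ y′ → x ≡ x′ × y ≡ y′
++-cut-unique-↑ hx hy hx′ hy′ =
  ++-cut-unique (λ s c q z sx py → <⇒≱ (hy′ c q z py) (hx s (c ∷ q) sx))
                (λ s c q z sx py → <⇒≱ (hy c q z py) (hx′ s (c ∷ q) sx))

++-cut-unique-↓ : StrictlyAboveEnd x → AboveStart y → StrictlyAboveEnd x′ → AboveStart y′ →
  x ++ y ≡ x′ ++ y′ → x ≡ x′ × y ≡ y′
++-cut-unique-↓ hx hy hx′ hy′ =
  ++-cut-unique (λ s c q z sx py → <⇒≱ (hx s c q sx) (hy′ (c ∷ q) z py))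
                (λ s c q z sx py → <⇒≱ (hx′ s c q sx) (hy (c ∷ q) z py))

factorization-cut-unique : BSeq i x → TSeq k y → BSeq i′ x′ → TSeq k′ y′ →
  x ++ y ≡ x′ ++ y′ → x ≡ x′ × y ≡ y′
factorization-cut-unique bx ty bx′ ty′ =
  ++-cut-unique-↑ (BSeq⇒AboveEnd bx) (TSeq⇒StrictlyAboveStart ty)
                  (BSeq⇒AboveEnd bx′) (TSeq⇒StrictlyAboveStart ty′)

Dyck-TSeq-cut-unique : Dyck D → TSeq k y → Dyck D′ → TSeq k′ y′ →
  D ++ y ≡ D′ ++ y′ → D ≡ D′ × y ≡ y′
Dyck-TSeq-cut-unique d ty d′ ty′ =
  ++-cut-unique-↑ (Dyck⇒AboveEnd d) (TSeq⇒StrictlyAboveStart ty)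
                  (Dyck⇒AboveEnd d′) (TSeq⇒StrictlyAboveStart ty′)

last-b-cut-unique : BSeq i x → Dyck D → BSeq i′ x′ → Dyck D′ →
  x ++ b ∷ D ≡ x′ ++ b ∷ D′ → x ≡ x′ × D ≡ D′
last-b-cut-unique {x = x} {D} {x′ = x′} {D′} bx d bx′ d′ eq
  with ++-cut-unique-↓ (AboveEnd⇒StrictlyAboveEnd-∷b (BSeq⇒AboveEnd bx)) (Dyck⇒AboveStart d)
                       (AboveEnd⇒StrictlyAboveEnd-∷b (BSeq⇒AboveEnd bx′)) (Dyck⇒AboveStart d′)
                       (trans (++-assoc x (b ∷ []) D) (trans eq (sym (++-assoc x′ (b ∷ []) D′))))
... | x∷b≡x′∷b , D≡D′ = ++-cancelʳ (b ∷ []) x x′ x∷b≡x′∷b , D≡D′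

BSeq⇒#t+i≡#b : BSeq i x → #t x + i ≡ #b x
BSeq⇒#t+i≡#b (bnil d) = trans (+-identityʳ _) (Dyck.balanced d)
BSeq⇒#t+i≡#b (bsnoc {i = i} {x = x} {D = D} bx d)
  rewrite #t-++ x (b ∷ D) | #b-++ x (b ∷ D) | sym (BSeq⇒#t+i≡#b bx) | sym (Dyck.balanced d) =
  [m+n]+1+o≡[m+o]+1+n (#t x) (#t D) i
  where
  [m+n]+1+o≡[m+o]+1+n : ∀ m n o → (m + n) + suc o ≡ (m + o) + suc n
  [m+n]+1+o≡[m+o]+1+n = solve-∀

TSeq⇒#t≡k+#b : TSeq k y → #t y ≡ k + #b y
TSeq⇒#t≡k+#b tnil = refl
TSeq⇒#t≡k+#b (tcons {k = k} {D = D} {y = y} d ty)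
  rewrite #t-++ D y | #b-++ D y | TSeq⇒#t≡k+#b ty | Dyck.balanced d =
  cong suc (m+[n+o]≡n+[m+o] (#b D) k (#b y))
  where
  m+[n+o]≡n+[m+o] : ∀ m n o → m + (n + o) ≡ n + (m + o)
  m+[n+o]≡n+[m+o] = solve-∀

Factorization⇒#t+i≡#b+k : Factorization w i k → #t w + i ≡ #b w + k
Factorization⇒#t+i≡#b+k {i = i} {k = k} (x , y , bx , ty , refl)
  rewrite #t-++ x y | #b-++ x y | TSeq⇒#t≡k+#b ty | sym (BSeq⇒#t+i≡#b bx) =
  [m+[n+o]]+p≡[[m+p]+o]+n (#t x) k (#b y) i
  where
  [m+[n+o]]+p≡[[m+p]+o]+n : ∀ m n o p → (m + (n + o)) + p ≡ ((m + p) + o) + n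
  [m+[n+o]]+p≡[[m+p]+o]+n = solve-∀

Factorization⇒k≤#t : Factorization w i k → k ≤ #t w
Factorization⇒k≤#t {k = k} (x , y , _ , ty , refl) = begin
  k            ≤⟨ m≤m+n k (#b y) ⟩
  k + #b y     ≡⟨ sym (TSeq⇒#t≡k+#b ty) ⟩
  #t y         ≤⟨ m≤n+m (#t y) (#t x) ⟩
  #t x + #t y  ≡⟨ sym (#t-++ x y) ⟩
  #t (x ++ y)  ∎
  where open ≤-Reasoning

switched-factorization : BSeq i x → Dyck D → TSeq k y → Factorization (x ++ b ∷ (D ++ y)) (suc i) k
switched-factorization {x = x} {D = D} {y = y} bx d ty =
  x ++ b ∷ D , y , bsnoc bx d , ty , sym (++-assoc x (b ∷ D) y)

last-unmatched-b-view : Factorization w (suc i) k →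
  ∃[ x ] ∃[ D ] ∃[ y ] (BSeq i x × Dyck D × TSeq k y × w ≡ x ++ b ∷ (D ++ y))
last-unmatched-b-view (_ , y , bsnoc {x = x} {D = D} bx d , ty , refl) =
  x , D , y , bx , d , ty , ++-assoc x (b ∷ D) y

switch-functional : ∀ {w₁ w₂} → Switch w w₁ → Switch w w₂ → w₁ ≡ w₂
switch-functional (_ , _ , x , D , y , bx , d , ty , refl , refl)
                  (_ , _ , x′ , D′ , y′ , bx′ , d′ , ty′ , eq , refl)
  with factorization-cut-unique bx (tcons d ty) bx′ (tcons d′ ty′) eq
... | refl , tDy≡tD′y′ with Dyck-TSeq-cut-unique d ty d′ ty′ (∷-injectiveʳ tDy≡tD′y′)
...   | refl , refl = refl

switch-injective : ∀ {w₁ w₂ w′} → Switch w₁ w′ → Switch w₂ w′ → w₁ ≡ w₂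
switch-injective (_ , _ , x , D , y , bx , d , ty , refl , refl)
                 (_ , _ , x′ , D′ , y′ , bx′ , d′ , ty′ , refl , eq)
  with factorization-cut-unique (bsnoc bx d) ty (bsnoc bx′ d′) ty′
         (trans (++-assoc x (b ∷ D) y) (trans eq (sym (++-assoc x′ (b ∷ D′) y′))))
... | xbD≡x′bD′ , refl with last-b-cut-unique bx d bx′ d′ xbD≡x′bD′
...   | refl , refl = refl

no-unmatched-t : Factorization w i 0 → #b w + 2 ≤ #t w + (i + 0) → ⊥
no-unmatched-t {w} {i} fac h = m+1+n≰m (#b w) (begin
  #b w + 2        ≤⟨ h ⟩
  #t w + (i + 0)  ≡⟨ cong (#t w +_) (+-identityʳ i) ⟩
  #t w + i        ≡⟨ Factorization⇒#t+i≡#b+k fac ⟩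
  #b w + 0        ≡⟨ +-identityʳ (#b w) ⟩
  #b w            ∎)
  where open ≤-Reasoning

no-unmatched-b : ∀ {e f} → Factorization w 0 k → #t w ≡ e ∸ 1 → #b w ≡ f + 1 → e ≤ f + k → ⊥
no-unmatched-b {w} {k} {e} {f} fac et fb h = <⇒≱ (+-monoˡ-< k (m<m+n f (s≤s z≤n))) (begin
  (f + 1) + k  ≡⟨ cong (_+ k) fb ⟨
  #b w + k     ≡⟨ Factorization⇒#t+i≡#b+k fac ⟨
  #t w + 0     ≡⟨ +-identityʳ (#t w) ⟩
  #t w         ≡⟨ et ⟩
  e ∸ 1        ≤⟨ m∸n≤m e 1 ⟩
  e            ≤⟨ h ⟩
  f + k        ∎)
  where open ≤-Reasoning

-- The unmatched t's are counted by #t w = e ∸ 1, so e = 0 (where ∸ truncates) would leave none.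
suc[e∸1]≡e : ∀ {e f} → Factorization w (suc i) k → #t w ≡ e ∸ 1 → #b w ≡ f + 1 →
  f + 2 ≤ e + (suc i + k) → suc (e ∸ 1) ≡ e
suc[e∸1]≡e {e = suc e} _ _ _ _ = refl
suc[e∸1]≡e {w} {i} {k} {zero} {f} fac et fb h
  with k | subst (k ≤_) et (Factorization⇒k≤#t fac) | Factorization⇒#t+i≡#b+k fac
... | zero | z≤n | count = ⊥-elim (<⇒≱ (+-monoʳ-< f (n<1+n 1)) (begin
  f + 2        ≤⟨ h ⟩
  suc i + 0    ≡⟨ +-identityʳ (suc i) ⟩
  suc i        ≡⟨ cong (_+ suc i) et ⟨
  #t w + suc i ≡⟨ count ⟩
  #b w + 0     ≡⟨ cong (_+ 0) fb ⟩
  (f + 1) + 0  ≡⟨ +-identityʳ (f + 1) ⟩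
  f + 1        ∎))
  where open ≤-Reasoning

switch-defined : ∀ {e f u} → f + 2 ≤ e + u → W e f u w →
  ∃[ w′ ] (Switch w w′ × W (e ∸ 1) (f + 1) u w′)
switch-defined h (refl , refl , _ , zero , fac , refl) = ⊥-elim (no-unmatched-t fac h)
switch-defined _ (refl , refl , i , suc k , (x , _ , bx , tcons {D = D} {y = y} d ty , refl) , refl) =
    x ++ b ∷ (D ++ y)
  , (i , k , x , D , y , bx , d , ty , refl , refl)
  , cong (_∸ 1) (sym (#t-switch x (D ++ y)))
  , trans (#b-switch x (D ++ y)) (+-comm 1 _)
  , (suc i , k , switched-factorization bx d ty , sym (+-suc i k))

switch-surjective : ∀ {e f u w′} → e ≤ f + u → f + 2 ≤ e + u → W (e ∸ 1) (f + 1) u w′ →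
  ∃[ w ] (W e f u w × Switch w w′)
switch-surjective h₁ _ (et , fb , zero , k , fac , refl) = ⊥-elim (no-unmatched-b fac et fb h₁)
switch-surjective {f = f} _ h₂ (et , fb , suc i , k , fac , refl) with last-unmatched-b-view fac
... | x , D , y , bx , d , ty , refl =
    x ++ t ∷ (D ++ y)
  , ( trans (#t-switch x (D ++ y)) (trans (cong suc et) (suc[e∸1]≡e fac et fb h₂))
    , suc-injective (trans (sym (#b-switch x (D ++ y))) (trans fb (+-comm f 1)))
    , (i , suc k , (x , _ , bx , tcons d ty , refl) , +-suc i k))
  , (i , k , x , D , y , bx , d , ty , refl , refl)

m∸n≤o⇒m≤n+o : ∀ m n {o} → m ∸ n ≤ o → m ≤ n + o
m∸n≤o⇒m≤n+o m n h = ≤-trans (m≤n+m∸n m n) (+-monoʳ-≤ n h)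

lemma3p4 : (e f u : ℕ) → e ∸ f ≤ u → (f + 2) ∸ e ≤ u →
    ((w : Word) → W e f u w → ∃[ w' ] (Switch w w' × W (e ∸ 1) (f + 1) u w'))
    × ((w w₁ w₂ : Word) → W e f u w → Switch w w₁ → Switch w w₂ → w₁ ≡ w₂)
    × ((w₁ w₂ w' : Word) → W e f u w₁ → W e f u w₂ → Switch w₁ w' → Switch w₂ w' → w₁ ≡ w₂)
    × ((w' : Word) → W (e ∸ 1) (f + 1) u w' → ∃[ w ] (W e f u w × Switch w w'))
lemma3p4 e f u e∸f≤u f+2∸e≤u =
    (λ _ → switch-defined f+2≤e+u)
  , (λ _ _ _ _ → switch-functional)
  , (λ _ _ _ _ _ → switch-injective)
  , (λ _ → switch-surjective (m∸n≤o⇒m≤n+o e f e∸f≤u) f+2≤e+u)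
  where
  f+2≤e+u : f + 2 ≤ e + u
  f+2≤e+u = m∸n≤o⇒m≤n+o (f + 2) e f+2∸e≤u
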